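{- Let $\widehat{G}$ be a graph with a 2-decomposition $\left(G,\{H_e\}_{e\in E}\right)$, $G=(V,E)$. Then \[ Z(\widehat{G};a,b)=\sum_{s\in\mathcal{S}(G)}a^{k(s)}\Big(\prod_{e\in s}\phi^{(1)}_e\Big)\Big(\prod_{e\notin s}\phi^{(2)}_e\Big), \] where $\phi^{(1)}_e(a,b)=\sum_{s\in\mathcal{S}^1(H_e)}a^{k(s)-1}b^{e(s)}$ and $\phi^{(2)}_e(a,b)=\sum_{s\in\mathcal{S}^2(H_e)}a^{k(s)-2}b^{e(s)}$.
   Context: Graphs may have loops and multiple edges. A state of a graph $F=(V,E)$ is a spanning subgraph $(V,E')$, $E'\subseteq E$; $\mathcal{S}(F)$ is the set of states (identified with edge subsets). $k(s)$ = number of connected components, $e(s)=|E'|$. $Z(F;a,b)=\sum_{s\in\mathcal{S}(F)}a^{k(s)}b^{e(s)}$. 2-sum: given graphs with distinguished edges, identify the two edges (choosing which endpoints are identified) and delete the identified edge. A 2-decomposition: $G=(V,E)$ is a graph; for each $e\in E$, $A_e$ is a graph with a distinguished non-loop edge, also called $e$, joining distinct vertices $u_e,w_e$; $\widehat{G}$ is obtained by taking, for every $e\in E$, the 2-sum of $G$ with $A_e$ along $e$ and the distinguished edge of $A_e$ (the vertices $u_e,w_e$ of $A_e$ being identified with the endpoints of $e$ in $G$); $H_e:=A_e\setminus e$; $(G,\{H_e\})$ is a 2-decomposition of $\widehat{G}$. $\mathcal{S}^1(H_e)$ (resp. $\mathcal{S}^2(H_e)$) is the set of states of $H_e$ in which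 $u_e$ and $w_e$ lie in the same (resp. different) connected component(s). -}

module Defs where

open import Level using (Level)
open import Data.Nat as ℕ using (ℕ; zero; suc; _∸_; _<ᵇ_)
open import Data.Fin as Fin using (Fin; zero; suc; toℕ; _↑ˡ_; _↑ʳ_; splitAt)
open import Data.Fin.Properties using () renaming (_≟_ to _≟ᶠ_)
open import Data.Bool using (Bool; true; false; _∧_; _∨_; not; if_then_else_)
open import Data.Product using (_×_; _,_; proj₁; proj₂; Σ)
open import Data.Sum using (inj₁; inj₂)
open import Data.List using (List; []; _∷_; concatMap; foldr; map)
open import Relation.Nullary.Decidable using (⌊_⌋)
open import Algebra.Bundles using (CommutativeSemiring)

anyFin : (n : ℕ) → (Fin n → Bool) → Bool
anyFin zero    f = false
anyFin (suc n) f = f zero ∨ anyFin n (λ i → f (suc i))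

countFin : (n : ℕ) → (Fin n → Bool) → ℕ
countFin zero    f = 0
countFin (suc n) f = (if f zero then 1 else 0) ℕ.+ countFin n (λ i → f (suc i))

sumFin : (m : ℕ) → (Fin m → ℕ) → ℕ
sumFin zero    p = 0
sumFin (suc m) p = p zero ℕ.+ sumFin m (λ i → p (suc i))

injΣ : (m : ℕ) (p : Fin m → ℕ) (i : Fin m) → Fin (p i) → Fin (sumFin m p)
injΣ (suc m) p zero    j = j ↑ˡ sumFin m (λ i → p (suc i))
injΣ (suc m) p (suc i) j = p zero ↑ʳ injΣ m (λ i → p (suc i)) i j

decΣ : (m : ℕ) (p : Fin m → ℕ) → Fin (sumFin m p) → Σ (Fin m) (λ i → Fin (p i))
decΣ (suc m) p x with splitAt (p zero) x
... | inj₁ j = zero , j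
... | inj₂ y with decΣ m (λ i → p (suc i)) y
...   | (i , j) = suc i , j

-- Graphs (loops and multiple edges allowed): vertex set Fin nV,
-- edge set Fin nE, each edge has an (ordered) pair of endpoints.

record Graph : Set where
  constructor graph
  field
    nV   : ℕ
    nE   : ℕ
    ends : Fin nE → Fin nV × Fin nV
open Graph public

-- A state = a spanning subgraph, identified with its edge subset.
State : Graph → Set
State F = Fin (nE F) → Bool

subsets : (m : ℕ) → List (Fin m → Bool)
subsets zero    = (λ ()) ∷ []
subsets (suc m) = concatMap (λ s → cons false s ∷ cons true s ∷ []) (subsets m)
  where
  cons : Bool → (Fin m → Bool) → Fin (suc m) → Bool
  cons b s zero    = b
  cons b s (suc i) = s i

states : (F : Graph) → List (State F)
states F = subsets (nE F)

numEdges : (F : Graph) → State F → ℕ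
numEdges F s = countFin (nE F) s

adjacent : (F : Graph) → State F → Fin (nV F) → Fin (nV F) → Bool
adjacent F s u v = anyFin (nE F) λ e →
  s e ∧ ((⌊ proj₁ (ends F e) ≟ᶠ u ⌋ ∧ ⌊ proj₂ (ends F e) ≟ᶠ v ⌋)
       ∨ (⌊ proj₁ (ends F e) ≟ᶠ v ⌋ ∧ ⌊ proj₂ (ends F e) ≟ᶠ u ⌋))

reachWithin : (F : Graph) → State F → ℕ → Fin (nV F) → Fin (nV F) → Bool
reachWithin F s zero    u v = ⌊ u ≟ᶠ v ⌋
reachWithin F s (suc k) u v =
  reachWithin F s k u v ∨ anyFin (nV F) (λ w → reachWithin F s k u w ∧ adjacent F s w v)

-- u and v lie in the same connected component of s
-- (walks of length ≤ nV suffice)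
connected : (F : Graph) → State F → Fin (nV F) → Fin (nV F) → Bool
connected F s = reachWithin F s (nV F)

-- k(s): number of connected components = number of vertices that are the
-- least vertex of their component
numComponents : (F : Graph) → State F → ℕ
numComponents F s = countFin (nV F) λ v →
  not (anyFin (nV F) (λ u → (toℕ u <ᵇ toℕ v) ∧ connected F s u v))

-- Two-terminal graphs: H_e = A_e \ e with vertex set Fin (2 + inner),
-- u_e = vertex 0, w_e = vertex 1 (distinct).  A_e is H_e plus the
-- distinguished edge joining 0 and 1.

record TGraph : Set where
  constructor tgraph
  field
    inner : ℕ
    tE    : ℕ
    tends : Fin tE → Fin (2 ℕ.+ inner) × Fin (2 ℕ.+ inner)
open TGraph public

toGraph : TGraph → Graph
toGraph H = graph (2 ℕ.+ inner H) (tE H) (tends H)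

u-term : (H : TGraph) → Fin (nV (toGraph H))
u-term H = zero

w-term : (H : TGraph) → Fin (nV (toGraph H))
w-term H = suc zero

withEdge : TGraph → Graph
withEdge H = graph (2 ℕ.+ inner H) (suc (tE H)) f
  where
  f : Fin (suc (tE H)) → Fin (2 ℕ.+ inner H) × Fin (2 ℕ.+ inner H)
  f zero    = zero , suc zero
  f (suc i) = tends H i

-- The graph Ĝ obtained from G by 2-summing A_e along each edge e of G:
-- u_e is identified with proj₁ (ends G e), w_e with proj₂ (ends G e),
-- the edge e is deleted; the inner vertices and edges of each H_e are
-- added disjointly.

twoSumAll : (G : Graph) → (Fin (nE G) → TGraph) → Graph
twoSumAll G H = graph N M endsHat
  where
  N : ℕ
  N = nV G ℕ.+ sumFin (nE G) (λ e → inner (H e))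
  M : ℕ
  M = sumFin (nE G) (λ e → tE (H e))
  vmap : (e : Fin (nE G)) → Fin (2 ℕ.+ inner (H e)) → Fin N
  vmap e zero          = proj₁ (ends G e) ↑ˡ _
  vmap e (suc zero)    = proj₂ (ends G e) ↑ˡ _
  vmap e (suc (suc j)) = nV G ↑ʳ injΣ (nE G) (λ e → inner (H e)) e j
  endsHat : Fin M → Fin N × Fin N
  endsHat x with decΣ (nE G) (λ e → tE (H e)) x
  ... | (e , j) = vmap e (proj₁ (tends (H e) j)) , vmap e (proj₂ (tends (H e) j))

module Eval {c ℓ : Level} (R : CommutativeSemiring c ℓ) where
  open CommutativeSemiring R using (Carrier; _+_; _*_; 0#; 1#)

  pow : Carrier → ℕ → Carrier
  pow x zero    = 1#
  pow x (suc n) = x * pow x n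

  sumL : {A : Set} → List A → (A → Carrier) → Carrier
  sumL xs f = foldr (λ x acc → f x + acc) 0# xs

  prodFin : (n : ℕ) → (Fin n → Carrier) → Carrier
  prodFin zero    f = 1#
  prodFin (suc n) f = f zero * prodFin n (λ i → f (suc i))

  Z : Graph → Carrier → Carrier → Carrier
  Z F a b = sumL (states F) λ s →
    pow a (numComponents F s) * pow b (numEdges F s)

  phi1 : TGraph → Carrier → Carrier → Carrier
  phi1 H a b = sumL (states (toGraph H)) λ s →
    if connected (toGraph H) s (u-term H) (w-term H)
    then pow a (numComponents (toGraph H) s ∸ 1) * pow b (numEdges (toGraph H) s)
    else 0#

  phi2 : TGraph → Carrier → Carrier → Carrier
  phi2 H a b = sumL (states (toGraph H)) λ s →
    if connected (toGraph H) s (u-term H) (w-term H)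
    then 0#
    else pow a (numComponents (toGraph H) s ∸ 2) * pow b (numEdges (toGraph H) s)

  rhs : (G : Graph) → (Fin (nE G) → TGraph) → Carrier → Carrier → Carrier
  rhs G H a b = sumL (states G) λ s →
    pow a (numComponents G s)
    * (prodFin (nE G) (λ e → if s e then phi1 (H e) a b else 1#)
       * prodFin (nE G) (λ e → if s e then 1# else phi2 (H e) a b))

-- A state x of Ĝ is a family of states t_e of the H_e. Let s be the state of G containing e
-- exactly when the terminals of H_e are joined in t_e. Then two vertices of G are joined in x
-- iff they are joined in s, and an inner vertex of H_e is least in its component of x iff it is
-- least in its component of t_e; so k(x) is k(s) plus the number of components of the t_e
-- containing no terminal, which is k(t_e) - 1 or k(t_e) - 2 according as e ∈ s or not.
-- Expanding the products on the right-hand side, the term indexed by a state s' of G and a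
-- family (t_e) vanishes unless s' = s, and otherwise equals the term of x on the left.

module Submission where

open import Defs
open import Level using (Level)
open import Data.Nat as ℕ using (ℕ; zero; suc; _∸_; _≤_; _<_; _<ᵇ_; z≤n; s≤s)
open import Data.Nat.Properties
  using ( m≤n⇒m≤1+n; +-monoʳ-<; +-cancelˡ-<; <-≤-trans; ≤-<-trans; m≤m+n; <-irrefl; <-asym; ≤⇒≯
        ; <ᵇ⇒<; <⇒<ᵇ)
import Data.Nat.Properties as ℕₚ
open import Data.Fin using (Fin; zero; suc; toℕ; _↑ˡ_; _↑ʳ_; splitAt)
open import Data.Fin.Properties
  using ( _≟_; splitAt-↑ˡ; splitAt-↑ʳ; splitAt⁻¹-↑ˡ; splitAt⁻¹-↑ʳ; toℕ-↑ˡ; toℕ-↑ʳ; toℕ<n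
        ; ↑ˡ-injective; ↑ʳ-injective)
open import Data.Bool using (Bool; true; false; _∧_; _∨_; not; if_then_else_; T)
open import Data.Bool.Properties using (T-∧; T-∨; ∨-comm; ∨-identityʳ)
open import Data.List using (List; []; _∷_; concatMap)
open import Data.Vec.Functional using () renaming (_∷_ to _∷ᵛ_; _++_ to _++ᵛ_)
open import Data.Product using (_×_; _,_; proj₁; proj₂; Σ; ∃-syntax)
open import Data.Sum as Sum using (_⊎_; inj₁; inj₂; [_,_]′)
open import Data.Empty using (⊥; ⊥-elim)
open import Function using (_∘_)
open import Function.Bundles using (module Equivalence)
open import Relation.Nullary using (¬_)
open import Relation.Nullary.Decidable using (⌊_⌋; toWitness; fromWitness)
open import Relation.Binary.PropositionalEquality
  using (_≡_; _≢_; _≗_; refl; sym; trans; cong; cong₂; subst; subst₂; module ≡-Reasoning)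
open import Algebra.Bundles using (CommutativeSemiring)

open Equivalence using (to; from)

T-⇔⇒≡ : ∀ {x y} → (T x → T y) → (T y → T x) → x ≡ y
T-⇔⇒≡ {false} {false} _ _ = refl
T-⇔⇒≡ {false} {true}  _ g = ⊥-elim (g _)
T-⇔⇒≡ {true}  {false} f _ = ⊥-elim (f _)
T-⇔⇒≡ {true}  {true}  _ _ = refl

T-not⁺ : ∀ {x} → ¬ T x → T (not x)
T-not⁺ {false} _  = _
T-not⁺ {true}  ¬x = ¬x _

T-not⁻ : ∀ {x} → T (not x) → ¬ T x
T-not⁻ {false} _ ()

anyFin⁺ : ∀ n {f : Fin n → Bool} i → T (f i) → T (anyFin n f)
anyFin⁺ (suc n) zero    p = from T-∨ (inj₁ p)
anyFin⁺ (suc n) (suc i) p = from T-∨ (inj₂ (anyFin⁺ n i p))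

anyFin⁻ : ∀ n {f : Fin n → Bool} → T (anyFin n f) → ∃[ i ] T (f i)
anyFin⁻ (suc n) p with to T-∨ p
... | inj₁ q = zero , q
... | inj₂ q with anyFin⁻ n q
...   | i , r = suc i , r

anyFin-cong : ∀ n {f g : Fin n → Bool} → f ≗ g → anyFin n f ≡ anyFin n g
anyFin-cong zero    f≗g = refl
anyFin-cong (suc n) f≗g = cong₂ _∨_ (f≗g zero) (anyFin-cong n (f≗g ∘ suc))

anyFin-false : ∀ n → anyFin n (λ _ → false) ≡ false
anyFin-false zero    = refl
anyFin-false (suc n) = anyFin-false n

countFin-cong : ∀ n {f g : Fin n → Bool} → f ≗ g → countFin n f ≡ countFin n g
countFin-cong zero    f≗g = refl
countFin-cong (suc n) f≗g =
  cong₂ (λ b c → (if b then 1 else 0) ℕ.+ c) (f≗g zero) (countFin-cong n (f≗g ∘ suc))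

sumFin-cong : ∀ m {p q : Fin m → ℕ} → p ≗ q → sumFin m p ≡ sumFin m q
sumFin-cong zero    p≗q = refl
sumFin-cong (suc m) p≗q = cong₂ ℕ._+_ (p≗q zero) (sumFin-cong m (p≗q ∘ suc))

countFin-≤ : ∀ n (f : Fin n → Bool) → countFin n f ≤ n
countFin-≤ zero    f = z≤n
countFin-≤ (suc n) f with f zero
... | true  = s≤s (countFin-≤ n (f ∘ suc))
... | false = m≤n⇒m≤1+n (countFin-≤ n (f ∘ suc))

_⊆ᵇ_ : ∀ {n} → (Fin n → Bool) → (Fin n → Bool) → Set
f ⊆ᵇ g = ∀ i → T (f i) → T (g i)

countFin-mono : ∀ n {f g : Fin n → Bool} → f ⊆ᵇ g → countFin n f ≤ countFin n g
countFin-mono zero    f⊆g = z≤n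
countFin-mono (suc n) {f} {g} f⊆g with f zero | g zero | f⊆g zero
... | false | false | _ = countFin-mono n (f⊆g ∘ suc)
... | false | true  | _ = m≤n⇒m≤1+n (countFin-mono n (f⊆g ∘ suc))
... | true  | true  | _ = s≤s (countFin-mono n (f⊆g ∘ suc))
... | true  | false | h = ⊥-elim (h _)

countFin-⊆ : ∀ n {f g : Fin n → Bool} → f ⊆ᵇ g → f ≗ g ⊎ countFin n f < countFin n g
countFin-⊆ zero    f⊆g = inj₁ λ ()
countFin-⊆ (suc n) {f} {g} f⊆g with f zero in f0 | g zero in g0 | countFin-⊆ n (f⊆g ∘ suc)
... | true  | false | _       = ⊥-elim (subst T g0 (f⊆g zero (subst T (sym f0) _)))
... | false | true  | _       = inj₂ (s≤s (countFin-mono n (f⊆g ∘ suc)))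
... | false | false | inj₂ lt = inj₂ lt
... | true  | true  | inj₂ lt = inj₂ (s≤s lt)
... | false | false | inj₁ eq = inj₁ λ { zero → trans f0 (sym g0) ; (suc i) → eq i }
... | true  | true  | inj₁ eq = inj₁ λ { zero → trans f0 (sym g0) ; (suc i) → eq i }

countFin-+ : ∀ n k (f : Fin (n ℕ.+ k) → Bool) →
  countFin (n ℕ.+ k) f ≡ countFin n (f ∘ (_↑ˡ k)) ℕ.+ countFin k (f ∘ (n ↑ʳ_))
countFin-+ zero    k f = refl
countFin-+ (suc n) k f =
  trans (cong ((if f zero then 1 else 0) ℕ.+_) (countFin-+ n k (f ∘ suc)))
        (sym (ℕₚ.+-assoc (if f zero then 1 else 0) _ _))

countFin-sumFin : ∀ m (q : Fin m → ℕ) (f : Fin (sumFin m q) → Bool) →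
  countFin (sumFin m q) f ≡ sumFin m (λ i → countFin (q i) (f ∘ injΣ m q i))
countFin-sumFin zero    q f = refl
countFin-sumFin (suc m) q f =
  trans (countFin-+ (q zero) _ f)
        (cong (countFin (q zero) (f ∘ (_↑ˡ _)) ℕ.+_)
              (countFin-sumFin m (q ∘ suc) (f ∘ (q zero ↑ʳ_))))

decΣ-injΣ : ∀ m (q : Fin m → ℕ) i j → decΣ m q (injΣ m q i j) ≡ (i , j)
decΣ-injΣ (suc m) q zero    j rewrite splitAt-↑ˡ (q zero) j (sumFin m (q ∘ suc)) = refl
decΣ-injΣ (suc m) q (suc i) j
  rewrite splitAt-↑ʳ (q zero) (sumFin m (q ∘ suc)) (injΣ m (q ∘ suc) i j)
        | decΣ-injΣ m (q ∘ suc) i j = refl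

injΣ-surjective : ∀ m (q : Fin m → ℕ) x → ∃[ i ] ∃[ j ] injΣ m q i j ≡ x
injΣ-surjective (suc m) q x with splitAt (q zero) x in eq
... | inj₁ j = zero , j , splitAt⁻¹-↑ˡ eq
... | inj₂ y with injΣ-surjective m (q ∘ suc) y
...   | i , j , refl = suc i , j , splitAt⁻¹-↑ʳ eq

injΣ-injective : ∀ m (q : Fin m → ℕ) {i i′ j j′} → injΣ m q i j ≡ injΣ m q i′ j′ →
  _≡_ {A = Σ (Fin m) (Fin ∘ q)} (i , j) (i′ , j′)
injΣ-injective m q {i} {i′} {j} {j′} eq =
  trans (sym (decΣ-injΣ m q i j)) (trans (cong (decΣ m q) eq) (decΣ-injΣ m q i′ j′))

injΣ-mono-< : ∀ m (q : Fin m → ℕ) i {j j′} → toℕ j < toℕ j′ →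
  toℕ (injΣ m q i j) < toℕ (injΣ m q i j′)
injΣ-mono-< (suc m) q zero {j} {j′} lt
  rewrite toℕ-↑ˡ j (sumFin m (q ∘ suc)) | toℕ-↑ˡ j′ (sumFin m (q ∘ suc)) = lt
injΣ-mono-< (suc m) q (suc i) {j} {j′} lt
  rewrite toℕ-↑ʳ (q zero) (injΣ m (q ∘ suc) i j) | toℕ-↑ʳ (q zero) (injΣ m (q ∘ suc) i j′)
  = +-monoʳ-< (q zero) (injΣ-mono-< m (q ∘ suc) i lt)

injΣ-cancel-< : ∀ m (q : Fin m → ℕ) i {j j′} → toℕ (injΣ m q i j) < toℕ (injΣ m q i j′) →
  toℕ j < toℕ j′
injΣ-cancel-< (suc m) q zero {j} {j′} lt
  rewrite toℕ-↑ˡ j (sumFin m (q ∘ suc)) | toℕ-↑ˡ j′ (sumFin m (q ∘ suc)) = lt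
injΣ-cancel-< (suc m) q (suc i) {j} {j′} lt
  rewrite toℕ-↑ʳ (q zero) (injΣ m (q ∘ suc) i j) | toℕ-↑ʳ (q zero) (injΣ m (q ∘ suc) i j′)
  = injΣ-cancel-< m (q ∘ suc) i (+-cancelˡ-< (q zero) _ _ lt)

↑ˡ<↑ʳ : ∀ {n k} (i : Fin n) (j : Fin k) → toℕ (i ↑ˡ k) < toℕ (n ↑ʳ j)
↑ˡ<↑ʳ {n} {k} i j rewrite toℕ-↑ˡ i k | toℕ-↑ʳ n j = <-≤-trans (toℕ<n i) (m≤m+n n (toℕ j))

↑ˡ≢↑ʳ : ∀ {n k} (i : Fin n) (j : Fin k) → i ↑ˡ k ≢ n ↑ʳ j
↑ˡ≢↑ʳ i j eq = <-irrefl (cong toℕ eq) (↑ˡ<↑ʳ i j)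

-- Connectivity

module Connectivity (F : Graph) (s : State F) where

  private
    V : Set
    V = Fin (nV F)

    ≟-pair : ∀ {x u y v : V} → T (⌊ x ≟ u ⌋ ∧ ⌊ y ≟ v ⌋) → (x , y) ≡ (u , v)
    ≟-pair {x} {u} p with to (T-∧ {⌊ x ≟ u ⌋}) p
    ... | x≟u , y≟v = cong₂ _,_ (toWitness x≟u) (toWitness y≟v)

    ≟-refl : ∀ (x : V) → T ⌊ x ≟ x ⌋
    ≟-refl x = fromWitness refl

  adjacent⁺ : ∀ {u v} e → T (s e) → ends F e ≡ (u , v) → T (adjacent F s u v)
  adjacent⁺ e se refl = anyFin⁺ (nE F) e
    (from T-∧ (se , from T-∨ (inj₁ (from T-∧ (≟-refl (proj₁ (ends F e)) , ≟-refl (proj₂ (ends F e)))))))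

  adjacent⁻ : ∀ {u v} → T (adjacent F s u v) →
    ∃[ e ] T (s e) × (ends F e ≡ (u , v) ⊎ ends F e ≡ (v , u))
  adjacent⁻ p with anyFin⁻ (nE F) p
  ... | e , q with to T-∧ q
  ...   | se , r = e , se , Sum.map ≟-pair ≟-pair (to T-∨ r)

  adjacent-sym : ∀ u v → adjacent F s u v ≡ adjacent F s v u
  adjacent-sym u v = anyFin-cong (nE F) λ e → cong (s e ∧_) (∨-comm (joins e u v) (joins e v u))
    where
    joins : Fin (nE F) → V → V → Bool
    joins e u v = ⌊ proj₁ (ends F e) ≟ u ⌋ ∧ ⌊ proj₂ (ends F e) ≟ v ⌋

  private
    R : ℕ → V → V → Bool
    R = reachWithin F s

  reachWithin-suc : ∀ k {u v} → T (R k u v) → T (R (suc k) u v)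
  reachWithin-suc k = from T-∨ ∘ inj₁

  reachWithin-step : ∀ k {u v w} → T (R k u v) → T (adjacent F s v w) → T (R (suc k) u w)
  reachWithin-step k {v = v} p q = from T-∨ (inj₂ (anyFin⁺ (nV F) v (from T-∧ (p , q))))

  reachWithin-refl : ∀ k u → T (R k u u)
  reachWithin-refl zero    u = fromWitness refl
  reachWithin-refl (suc k) u = reachWithin-suc k (reachWithin-refl k u)

  reachWithin-induction : ∀ (P : V → Set) {u} → P u →
    (∀ {x y} → P x → T (adjacent F s x y) → P y) → ∀ k {v} → T (R k u v) → P v
  reachWithin-induction P Pu step zero    p = subst P (toWitness p) Pu
  reachWithin-induction P Pu step (suc k) p with to T-∨ p
  ... | inj₁ q = reachWithin-induction P Pu step k q
  ... | inj₂ q with anyFin⁻ (nV F) q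
  ...   | w , r = step (reachWithin-induction P Pu step k (proj₁ (to T-∧ r))) (proj₂ (to T-∧ r))

  reachWithin-stable-suc : ∀ k {u} → R k u ≗ R (suc k) u → R (suc k) u ≗ R (suc (suc k)) u
  reachWithin-stable-suc k {u} stable v = T-⇔⇒≡ (reachWithin-suc (suc k)) back
    where
    back : T (R (suc (suc k)) u v) → T (R (suc k) u v)
    back p with to T-∨ p
    ... | inj₁ q = q
    ... | inj₂ q with anyFin⁻ (nV F) q
    ...   | w , r = reachWithin-step k (subst T (sym (stable w)) (proj₁ (to T-∧ r))) (proj₂ (to T-∧ r))

  -- A step that changes the reachable set adds a vertex, so after nV F steps nothing changes.
  reachWithin-saturates : ∀ k u → R k u ≗ R (suc k) u ⊎ k ≤ countFin (nV F) (R k u)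
  reachWithin-saturates zero    u = inj₂ z≤n
  reachWithin-saturates (suc k) u
    with reachWithin-saturates k u | countFin-⊆ (nV F) (λ v → reachWithin-suc k {u} {v})
  ... | inj₁ stable | _           = inj₁ (reachWithin-stable-suc k stable)
  ... | inj₂ _      | inj₁ stable = inj₁ (reachWithin-stable-suc k stable)
  ... | inj₂ k≤     | inj₂ grows  = inj₂ (≤-<-trans k≤ grows)

  reachWithin-saturated : ∀ u → R (nV F) u ≗ R (suc (nV F)) u
  reachWithin-saturated u
    with reachWithin-saturates (nV F) u | countFin-⊆ (nV F) (λ v → reachWithin-suc (nV F) {u} {v})
  ... | inj₁ stable | _           = stable
  ... | inj₂ _      | inj₁ stable = stable
  ... | inj₂ n≤     | inj₂ grows  = ⊥-elim (≤⇒≯ (countFin-≤ (nV F) _) (≤-<-trans n≤ grows))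

  connected-refl : ∀ u → T (connected F s u u)
  connected-refl = reachWithin-refl (nV F)

  connected-step : ∀ {u v w} → T (connected F s u v) → T (adjacent F s v w) → T (connected F s u w)
  connected-step {u} {w = w} p q =
    subst T (sym (reachWithin-saturated u w)) (reachWithin-step (nV F) p q)

  connected-induction : ∀ (P : V → Set) {u} → P u →
    (∀ {x y} → P x → T (adjacent F s x y) → P y) → ∀ {v} → T (connected F s u v) → P v
  connected-induction P Pu step = reachWithin-induction P Pu step (nV F)

  connected-trans : ∀ {u v w} → T (connected F s u v) → T (connected F s v w) → T (connected F s u w)
  connected-trans {u} p = connected-induction (T ∘ connected F s u) p connected-step

  adjacent⇒connected : ∀ {u v} → T (adjacent F s u v) → T (connected F s u v)
  adjacent⇒connected = connected-step (connected-refl _)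

  connected-sym : ∀ {u v} → T (connected F s u v) → T (connected F s v u)
  connected-sym {u} = connected-induction (λ z → T (connected F s z u)) (connected-refl u)
    λ {x} {y} xu xy → connected-trans (adjacent⇒connected (subst T (adjacent-sym x y) xy)) xu

open Connectivity

module _ (F : Graph) {s s′ : State F} (s≗s′ : s ≗ s′) where

  adjacent-cong : ∀ u v → adjacent F s u v ≡ adjacent F s′ u v
  adjacent-cong u v = anyFin-cong (nE F) λ e → cong (_∧ _) (s≗s′ e)

  reachWithin-cong : ∀ k u v → reachWithin F s k u v ≡ reachWithin F s′ k u v
  reachWithin-cong zero    u v = refl
  reachWithin-cong (suc k) u v = cong₂ _∨_ (reachWithin-cong k u v)
    (anyFin-cong (nV F) λ w → cong₂ _∧_ (reachWithin-cong k u w) (adjacent-cong w v))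

  connected-cong : ∀ u v → connected F s u v ≡ connected F s′ u v
  connected-cong = reachWithin-cong (nV F)

  numComponents-cong : numComponents F s ≡ numComponents F s′
  numComponents-cong = countFin-cong (nV F) λ v →
    cong not (anyFin-cong (nV F) λ u → cong (_ ∧_) (connected-cong u v))

  numEdges-cong : numEdges F s ≡ numEdges F s′
  numEdges-cong = countFin-cong (nE F) s≗s′

-- numComponents F s is, by definition, countFin (nV F) (leastInComponent F s).
leastInComponent : (F : Graph) → State F → Fin (nV F) → Bool
leastInComponent F s v = not (anyFin (nV F) λ u → (toℕ u <ᵇ toℕ v) ∧ connected F s u v)

module _ (F : Graph) (s : State F) where

  leastInComponent⁺ : ∀ {v} → (∀ u → toℕ u < toℕ v → ¬ T (connected F s u v)) →
    T (leastInComponent F s v)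
  leastInComponent⁺ h = T-not⁺ λ p → let (u , q) = anyFin⁻ (nV F) p ; (lt , c) = to T-∧ q in
    h u (<ᵇ⇒< _ _ lt) c

  leastInComponent⁻ : ∀ {u v} → T (leastInComponent F s v) → toℕ u < toℕ v →
    ¬ T (connected F s u v)
  leastInComponent⁻ {u} p lt c = T-not⁻ p (anyFin⁺ (nV F) u (from T-∧ (<⇒<ᵇ lt , c)))

-- Components of a 2-sum

terminalsJoined : (G : Graph) (H : Fin (nE G) → TGraph) →
  ((e : Fin (nE G)) → State (toGraph (H e))) → State G
terminalsJoined G H t e = connected (toGraph (H e)) (t e) zero (suc zero)

numInnerComponents : (H : TGraph) → State (toGraph H) → ℕ
numInnerComponents H t = countFin (inner H) λ j → leastInComponent (toGraph H) t (suc (suc j))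

numComponents-terminals : ∀ H t → numComponents (toGraph H) t ≡
  (if connected (toGraph H) t zero (suc zero) then 1 else 2) ℕ.+ numInnerComponents H t
numComponents-terminals H t =
  trans (cong₂ (λ l₀ l₁ → (if l₀ then 1 else 0) ℕ.+ ((if l₁ then 1 else 0) ℕ.+ numInnerComponents H t))
               terminal₀-least terminal₁-least)
        (count c)
  where
  c : Bool
  c = connected (toGraph H) t zero (suc zero)

  terminal₀-least : leastInComponent (toGraph H) t zero ≡ true
  terminal₀-least = cong not (anyFin-false (2 ℕ.+ inner H))

  terminal₁-least : leastInComponent (toGraph H) t (suc zero) ≡ not c
  terminal₁-least = cong not (trans (cong (c ∨_) (anyFin-false (inner H))) (∨-identityʳ c))

  count : ∀ j → suc ((if not j then 1 else 0) ℕ.+ numInnerComponents H t)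
              ≡ (if j then 1 else 2) ℕ.+ numInnerComponents H t
  count true  = refl
  count false = refl

module TwoSum (G : Graph) (H : Fin (nE G) → TGraph) where

  private
    m n K : ℕ
    m = nE G
    n = nV G
    K = sumFin m (inner ∘ H)

    Ĝ : Graph
    Ĝ = twoSumAll G H

    Hᵍ : Fin m → Graph
    Hᵍ e = toGraph (H e)

  restrict : State Ĝ → (e : Fin m) → State (Hᵍ e)
  restrict x e = x ∘ injΣ m (tE ∘ H) e

  embed : (e : Fin m) → Fin (nV (Hᵍ e)) → Fin (nV Ĝ)
  embed e zero          = proj₁ (ends G e) ↑ˡ K
  embed e (suc zero)    = proj₂ (ends G e) ↑ˡ K
  embed e (suc (suc j)) = n ↑ʳ injΣ m (inner ∘ H) e j

  ends-injΣ : ∀ e k → ends Ĝ (injΣ m (tE ∘ H) e k) ≡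
    (embed e (proj₁ (tends (H e) k)) , embed e (proj₂ (tends (H e) k)))
  -- The vertex map inside twoSumAll cannot be named; it agrees with embed on each vertex shape.
  ends-injΣ e k rewrite decΣ-injΣ m (tE ∘ H) e k
    with proj₁ (tends (H e) k) | proj₂ (tends (H e) k)
  ... | zero        | zero        = refl
  ... | zero        | suc zero    = refl
  ... | zero        | suc (suc _) = refl
  ... | suc zero    | zero        = refl
  ... | suc zero    | suc zero    = refl
  ... | suc zero    | suc (suc _) = refl
  ... | suc (suc _) | zero        = refl
  ... | suc (suc _) | suc zero    = refl
  ... | suc (suc _) | suc (suc _) = refl

  embed-< : ∀ e j h → toℕ h < toℕ {nV (Hᵍ e)} (suc (suc j)) →
    toℕ (embed e h) < toℕ (embed e (suc (suc j)))
  embed-< e j zero                 _               = ↑ˡ<↑ʳ (proj₁ (ends G e)) _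
  embed-< e j (suc zero)           _               = ↑ˡ<↑ʳ (proj₂ (ends G e)) _
  embed-< e j (suc (suc j′)) (s≤s (s≤s lt))
    rewrite toℕ-↑ʳ n (injΣ m (inner ∘ H) e j′) | toℕ-↑ʳ n (injΣ m (inner ∘ H) e j)
    = +-monoʳ-< n (injΣ-mono-< m (inner ∘ H) e lt)

  embed-inner-cancel-< : ∀ e {j j′} → toℕ (embed e (suc (suc j))) < toℕ (embed e (suc (suc j′))) →
    toℕ j < toℕ j′
  embed-inner-cancel-< e {j} {j′} lt
    rewrite toℕ-↑ʳ n (injΣ m (inner ∘ H) e j) | toℕ-↑ʳ n (injΣ m (inner ∘ H) e j′)
    = injΣ-cancel-< m (inner ∘ H) e (+-cancelˡ-< n _ _ lt)

  module _ (x : State Ĝ) where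

    private
      sᴳ : State G
      sᴳ = terminalsJoined G H (restrict x)

      CG : Fin n → Fin n → Bool
      CG = connected G sᴳ

      CĜ : Fin (nV Ĝ) → Fin (nV Ĝ) → Bool
      CĜ = connected Ĝ x

      CH : (e : Fin m) → Fin (nV (Hᵍ e)) → Fin (nV (Hᵍ e)) → Bool
      CH e = connected (Hᵍ e) (restrict x e)

    adjacent-twoSum⁻ : ∀ {z z′} → T (adjacent Ĝ x z z′) →
      ∃[ e ] ∃[ h ] ∃[ h′ ] T (adjacent (Hᵍ e) (restrict x e) h h′) × z ≡ embed e h × z′ ≡ embed e h′
    adjacent-twoSum⁻ p with adjacent⁻ Ĝ x p
    ... | d , xd , joined with injΣ-surjective m (tE ∘ H) d
    ...   | e , k , refl rewrite ends-injΣ e k with joined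
    ...     | inj₁ refl = e , _ , _ , adjacent⁺ (Hᵍ e) (restrict x e) k xd refl , refl , refl
    ...     | inj₂ refl = e , _ , _ ,
      subst T (adjacent-sym (Hᵍ e) (restrict x e) _ _) (adjacent⁺ (Hᵍ e) (restrict x e) k xd refl) ,
      refl , refl

    adjacent-twoSum⁺ : ∀ e {h h′} → T (adjacent (Hᵍ e) (restrict x e) h h′) →
      T (adjacent Ĝ x (embed e h) (embed e h′))
    adjacent-twoSum⁺ e p with adjacent⁻ (Hᵍ e) (restrict x e) p
    ... | k , xk , inj₁ refl = adjacent⁺ Ĝ x (injΣ m (tE ∘ H) e k) xk (ends-injΣ e k)
    ... | k , xk , inj₂ refl = subst T (adjacent-sym Ĝ x _ _)
                                 (adjacent⁺ Ĝ x (injΣ m (tE ∘ H) e k) xk (ends-injΣ e k))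

    connected-embed : ∀ e {h h′} → T (CH e h h′) → T (CĜ (embed e h) (embed e h′))
    connected-embed e {h} = connected-induction (Hᵍ e) (restrict x e) (λ y → T (CĜ (embed e h) (embed e y)))
      (connected-refl Ĝ x _) λ c a → connected-step Ĝ x c (adjacent-twoSum⁺ e a)

    module _ (p : Fin n) where

      -- Reached describes the component of p ↑ˡ K in x through G and the H e; it is closed under adjacency.
      private
        Linked : (e : Fin m) → Fin (nV (Hᵍ e)) → Set
        Linked e h = T (CH e zero h) × T (CG p (proj₁ (ends G e)))
                   ⊎ T (CH e (suc zero) h) × T (CG p (proj₂ (ends G e)))

        Reached : Fin (nV Ĝ) → Set
        Reached z = (∃[ q ] z ≡ q ↑ˡ K × T (CG p q))
                  ⊎ (∃[ e ] ∃[ j ] z ≡ n ↑ʳ injΣ m (inner ∘ H) e j × Linked e (suc (suc j)))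

        Linked-step : ∀ e {h h′} → Linked e h → T (adjacent (Hᵍ e) (restrict x e) h h′) → Linked e h′
        Linked-step e (inj₁ (c , d)) a = inj₁ (connected-step (Hᵍ e) (restrict x e) c a , d)
        Linked-step e (inj₂ (c , d)) a = inj₂ (connected-step (Hᵍ e) (restrict x e) c a , d)

        Linked⇒Reached : ∀ e h → Linked e h → Reached (embed e h)
        Linked⇒Reached e zero          (inj₁ (_ , d)) = inj₁ (_ , refl , d)
        Linked⇒Reached e zero          (inj₂ (c , d)) = inj₁ (_ , refl , connected-step G sᴳ d
          (subst T (adjacent-sym G sᴳ _ _)
            (adjacent⁺ G sᴳ e (connected-sym (Hᵍ e) (restrict x e) c) refl)))
        Linked⇒Reached e (suc zero)    (inj₁ (c , d)) = inj₁ (_ , refl , connected-step G sᴳ d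
          (adjacent⁺ G sᴳ e c refl))
        Linked⇒Reached e (suc zero)    (inj₂ (_ , d)) = inj₁ (_ , refl , d)
        Linked⇒Reached e (suc (suc j)) l              = inj₂ (e , j , refl , l)

        Reached⇒Linked : ∀ e h → Reached (embed e h) → Linked e h
        Reached⇒Linked e zero (inj₁ (q , eq , c)) rewrite ↑ˡ-injective K _ _ eq =
          inj₁ (connected-refl (Hᵍ e) (restrict x e) zero , c)
        Reached⇒Linked e (suc zero) (inj₁ (q , eq , c)) rewrite ↑ˡ-injective K _ _ eq =
          inj₂ (connected-refl (Hᵍ e) (restrict x e) (suc zero) , c)
        Reached⇒Linked e zero          (inj₂ (_ , _ , eq , _)) = ⊥-elim (↑ˡ≢↑ʳ _ _ eq)
        Reached⇒Linked e (suc zero)    (inj₂ (_ , _ , eq , _)) = ⊥-elim (↑ˡ≢↑ʳ _ _ eq)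
        Reached⇒Linked e (suc (suc j)) (inj₁ (_ , eq , _))     = ⊥-elim (↑ˡ≢↑ʳ _ _ (sym eq))
        Reached⇒Linked e (suc (suc j)) (inj₂ (_ , _ , eq , l))
          with injΣ-injective m (inner ∘ H) (↑ʳ-injective n _ _ eq)
        ... | refl = l

        Reached-step : ∀ {z z′} → Reached z → T (adjacent Ĝ x z z′) → Reached z′
        Reached-step r a with adjacent-twoSum⁻ a
        ... | e , h , h′ , a′ , refl , refl = Linked⇒Reached e h′ (Linked-step e (Reached⇒Linked e h r) a′)

      connected-↑ˡ⁻ : ∀ {q} → T (CĜ (p ↑ˡ K) (q ↑ˡ K)) → T (CG p q)
      connected-↑ˡ⁻ c
        with connected-induction Ĝ x Reached (inj₁ (p , refl , connected-refl G sᴳ p)) Reached-step c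
      ... | inj₁ (_ , eq , d) rewrite ↑ˡ-injective K _ _ eq = d
      ... | inj₂ (_ , _ , eq , _) = ⊥-elim (↑ˡ≢↑ʳ _ _ eq)

      connected-↑ˡ⁺ : ∀ {q} → T (CG p q) → T (CĜ (p ↑ˡ K) (q ↑ˡ K))
      connected-↑ˡ⁺ = connected-induction G sᴳ (λ y → T (CĜ (p ↑ˡ K) (y ↑ˡ K)))
        (connected-refl Ĝ x _) step
        where
        step : ∀ {y y′} → T (CĜ (p ↑ˡ K) (y ↑ˡ K)) → T (adjacent G sᴳ y y′) →
          T (CĜ (p ↑ˡ K) (y′ ↑ˡ K))
        step c a = let e , joined , ends≡ = adjacent⁻ G sᴳ a in connected-trans Ĝ x c (glued e joined ends≡)
          where
          glued : ∀ e {y y′} → T (sᴳ e) → ends G e ≡ (y , y′) ⊎ ends G e ≡ (y′ , y) →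
            T (CĜ (y ↑ˡ K) (y′ ↑ˡ K))
          glued e joined (inj₁ refl) = connected-embed e joined
          glued e joined (inj₂ refl) = connected-sym Ĝ x (connected-embed e joined)

    connected-↑ˡ : ∀ p q → CĜ (p ↑ˡ K) (q ↑ˡ K) ≡ CG p q
    connected-↑ˡ p q = T-⇔⇒≡ (connected-↑ˡ⁻ p) (connected-↑ˡ⁺ p)

    leastInComponent-↑ˡ : ∀ v → leastInComponent Ĝ x (v ↑ˡ K) ≡ leastInComponent G sᴳ v
    leastInComponent-↑ˡ v = T-⇔⇒≡ ⇒ ⇐
      where
      ⇒ : T (leastInComponent Ĝ x (v ↑ˡ K)) → T (leastInComponent G sᴳ v)
      ⇒ l = leastInComponent⁺ G sᴳ λ u lt c →
        leastInComponent⁻ Ĝ x l (subst₂ _<_ (sym (toℕ-↑ˡ u K)) (sym (toℕ-↑ˡ v K)) lt)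
                                (subst T (sym (connected-↑ˡ u v)) c)

      ⇐ : T (leastInComponent G sᴳ v) → T (leastInComponent Ĝ x (v ↑ˡ K))
      ⇐ l = leastInComponent⁺ Ĝ x below
        where
        below : ∀ u → toℕ u < toℕ (v ↑ˡ K) → ¬ T (CĜ u (v ↑ˡ K))
        below u lt c with splitAt n u in eq
        ... | inj₁ u′ with refl ← splitAt⁻¹-↑ˡ eq =
          leastInComponent⁻ G sᴳ l (subst₂ _<_ (toℕ-↑ˡ u′ K) (toℕ-↑ˡ v K) lt)
                                   (subst T (connected-↑ˡ u′ v) c)
        ... | inj₂ y with refl ← splitAt⁻¹-↑ʳ eq = <-asym lt (↑ˡ<↑ʳ v y)

    module _ (e : Fin m) (j : Fin (inner (H e))) where

      private
        v : Fin (nV Ĝ)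
        v = n ↑ʳ injΣ m (inner ∘ H) e j

        Inside : Fin (nV Ĝ) → Set
        Inside z = ∃[ j′ ] z ≡ n ↑ʳ injΣ m (inner ∘ H) e j′ × T (CH e (suc (suc j)) (suc (suc j′)))

        -- An inner vertex not joined to a terminal keeps its component when H e is glued in.
        Inside-step : ¬ T (CH e zero (suc (suc j))) → ¬ T (CH e (suc zero) (suc (suc j))) →
          ∀ {z z′} → Inside z → T (adjacent Ĝ x z z′) → Inside z′
        Inside-step ¬u ¬w (j₁ , refl , c) a with adjacent-twoSum⁻ a
        ... | _ , zero          , _ , _ , eq , _ = ⊥-elim (↑ˡ≢↑ʳ _ _ (sym eq))
        ... | _ , suc zero      , _ , _ , eq , _ = ⊥-elim (↑ˡ≢↑ʳ _ _ (sym eq))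
        ... | _ , suc (suc j₂)  , h′ , a′ , eq , refl
          with injΣ-injective m (inner ∘ H) (↑ʳ-injective n _ _ eq)
        ...   | refl with h′ | connected-step (Hᵍ e) (restrict x e) c a′
        ...     | zero         | c′ = ⊥-elim (¬u (connected-sym (Hᵍ e) (restrict x e) c′))
        ...     | suc zero     | c′ = ⊥-elim (¬w (connected-sym (Hᵍ e) (restrict x e) c′))
        ...     | suc (suc j₃) | c′ = j₃ , refl , c′

      leastInComponent-↑ʳ : leastInComponent Ĝ x v ≡ leastInComponent (Hᵍ e) (restrict x e) (suc (suc j))
      leastInComponent-↑ʳ = T-⇔⇒≡ ⇒ ⇐
        where
        ⇒ : T (leastInComponent Ĝ x v) → T (leastInComponent (Hᵍ e) (restrict x e) (suc (suc j)))
        ⇒ l = leastInComponent⁺ (Hᵍ e) (restrict x e) λ h lt c →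
          leastInComponent⁻ Ĝ x l (embed-< e j h lt) (connected-embed e c)

        ⇐ : T (leastInComponent (Hᵍ e) (restrict x e) (suc (suc j))) → T (leastInComponent Ĝ x v)
        ⇐ l = leastInComponent⁺ Ĝ x λ u lt c → below lt
          (connected-induction Ĝ x Inside (j , refl , connected-refl (Hᵍ e) (restrict x e) _)
            (Inside-step (leastInComponent⁻ (Hᵍ e) _ l (s≤s z≤n))
                         (leastInComponent⁻ (Hᵍ e) _ l (s≤s (s≤s z≤n))))
            (connected-sym Ĝ x c))
          where
          below : ∀ {u} → toℕ u < toℕ v → Inside u → ⊥
          below lt (j′ , refl , c′) = leastInComponent⁻ (Hᵍ e) (restrict x e) l
            (s≤s (s≤s (embed-inner-cancel-< e lt))) (connected-sym (Hᵍ e) (restrict x e) c′)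

    numComponents-twoSum : numComponents Ĝ x ≡
      numComponents G sᴳ ℕ.+ sumFin m (λ e → numInnerComponents (H e) (restrict x e))
    numComponents-twoSum = begin
      countFin (n ℕ.+ K) (leastInComponent Ĝ x)
        ≡⟨ countFin-+ n K _ ⟩
      countFin n (leastInComponent Ĝ x ∘ (_↑ˡ K)) ℕ.+ countFin K (leastInComponent Ĝ x ∘ (n ↑ʳ_))
        ≡⟨ cong₂ ℕ._+_ (countFin-cong n leastInComponent-↑ˡ) (countFin-sumFin m (inner ∘ H) _) ⟩
      numComponents G sᴳ ℕ.+
        sumFin m (λ e → countFin (inner (H e)) (leastInComponent Ĝ x ∘ (n ↑ʳ_) ∘ injΣ m (inner ∘ H) e))
        ≡⟨ cong (numComponents G sᴳ ℕ.+_)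
                (sumFin-cong m λ e → countFin-cong (inner (H e)) (leastInComponent-↑ʳ e)) ⟩
      numComponents G sᴳ ℕ.+ sumFin m (λ e → numInnerComponents (H e) (restrict x e)) ∎
      where open ≡-Reasoning

    numEdges-twoSum : numEdges Ĝ x ≡ sumFin m (λ e → numEdges (Hᵍ e) (restrict x e))
    numEdges-twoSum = countFin-sumFin m (tE ∘ H) x

-- Sums in a commutative semiring

module Sums {c ℓ : Level} (R : CommutativeSemiring c ℓ) where

  open CommutativeSemiring R hiding (zero; refl; sym; trans)
  open CommutativeSemiring R using () renaming (refl to ≈-refl; sym to ≈-sym; trans to ≈-trans)
  open Eval R
  open import Relation.Binary.Reasoning.Setoid setoid
  open import Algebra.Properties.CommutativeSemigroup +-commutativeSemigroup
    using () renaming (interchange to +-interchange)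
  open import Algebra.Properties.CommutativeSemigroup *-commutativeSemigroup
    using () renaming (interchange to *-interchange)

  sumL-cong : ∀ {A : Set} (xs : List A) {f g : A → Carrier} → (∀ x → f x ≈ g x) → sumL xs f ≈ sumL xs g
  sumL-cong []       f≈g = ≈-refl
  sumL-cong (x ∷ xs) f≈g = +-cong (f≈g x) (sumL-cong xs f≈g)

  sumL-zero : ∀ {A : Set} (xs : List A) → sumL xs (λ _ → 0#) ≈ 0#
  sumL-zero []       = ≈-refl
  sumL-zero (x ∷ xs) = ≈-trans (+-identityˡ _) (sumL-zero xs)

  sumL-+ : ∀ {A : Set} (xs : List A) (f g : A → Carrier) →
    sumL xs (λ x → f x + g x) ≈ sumL xs f + sumL xs g
  sumL-+ []       f g = ≈-sym (+-identityʳ 0#)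
  sumL-+ (x ∷ xs) f g = ≈-trans (+-congˡ (sumL-+ xs f g)) (+-interchange (f x) (g x) _ _)

  sumL-*ˡ : ∀ {A : Set} (xs : List A) (k : Carrier) (f : A → Carrier) →
    k * sumL xs f ≈ sumL xs (λ x → k * f x)
  sumL-*ˡ []       k f = zeroʳ k
  sumL-*ˡ (x ∷ xs) k f = ≈-trans (distribˡ k (f x) _) (+-congˡ (sumL-*ˡ xs k f))

  sumL-*ʳ : ∀ {A : Set} (xs : List A) (k : Carrier) (f : A → Carrier) →
    sumL xs f * k ≈ sumL xs (λ x → f x * k)
  sumL-*ʳ xs k f = ≈-trans (*-comm _ k) (≈-trans (sumL-*ˡ xs k f) (sumL-cong xs λ x → *-comm k (f x)))

  sumL-swap : ∀ {A B : Set} (xs : List A) (ys : List B) (f : A → B → Carrier) →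
    sumL xs (λ x → sumL ys (f x)) ≈ sumL ys (λ y → sumL xs (λ x → f x y))
  sumL-swap []       ys f = ≈-sym (sumL-zero ys)
  sumL-swap (x ∷ xs) ys f = ≈-trans (+-congˡ (sumL-swap xs ys f)) (≈-sym (sumL-+ ys (f x) _))

  sumL-concatMap-pair : ∀ {A B : Set} (xs : List A) (g₀ g₁ : A → B) (f : B → Carrier) →
    sumL (concatMap (λ x → g₀ x ∷ g₁ x ∷ []) xs) f ≈ sumL xs (λ x → f (g₀ x) + f (g₁ x))
  sumL-concatMap-pair []       g₀ g₁ f = ≈-refl
  sumL-concatMap-pair (x ∷ xs) g₀ g₁ f =
    ≈-trans (+-congˡ (+-congˡ (sumL-concatMap-pair xs g₀ g₁ f))) (≈-sym (+-assoc _ _ _))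

  prodFin-cong : ∀ k {f g : Fin k → Carrier} → (∀ i → f i ≈ g i) → prodFin k f ≈ prodFin k g
  prodFin-cong zero    f≈g = ≈-refl
  prodFin-cong (suc k) f≈g = *-cong (f≈g zero) (prodFin-cong k (f≈g ∘ suc))

  prodFin-* : ∀ k (f g : Fin k → Carrier) → prodFin k (λ i → f i * g i) ≈ prodFin k f * prodFin k g
  prodFin-* zero    f g = ≈-sym (*-identityˡ 1#)
  prodFin-* (suc k) f g = ≈-trans (*-congˡ (prodFin-* k (f ∘ suc) (g ∘ suc))) (*-interchange (f zero) (g zero) _ _)

  pow-+ : ∀ x i j → pow x (i ℕ.+ j) ≈ pow x i * pow x j
  pow-+ x zero    j = ≈-sym (*-identityˡ _)
  pow-+ x (suc i) j = ≈-trans (*-congˡ (pow-+ x i j)) (≈-sym (*-assoc _ _ _))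

  pow-sumFin : ∀ x k (f : Fin k → ℕ) → pow x (sumFin k f) ≈ prodFin k (pow x ∘ f)
  pow-sumFin x zero    f = ≈-refl
  pow-sumFin x (suc k) f = ≈-trans (pow-+ x (f zero) _) (*-congˡ (pow-sumFin x k (f ∘ suc)))

  Extensional : ∀ {k} → ((Fin k → Bool) → Carrier) → Set _
  Extensional f = ∀ {s s′} → s ≗ s′ → f s ≈ f s′

  subsets-suc : ∀ k {f : (Fin (suc k) → Bool) → Carrier} → Extensional f →
    sumL (subsets (suc k)) f ≈ sumL (subsets k) (λ s → f (false ∷ᵛ s) + f (true ∷ᵛ s))
  subsets-suc k ext = ≈-trans (sumL-concatMap-pair (subsets k) _ _ _) (sumL-cong (subsets k) λ s →
    +-cong (ext λ { zero → refl ; (suc i) → refl }) (ext λ { zero → refl ; (suc i) → refl }))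

  private
    ∷-cong : ∀ {k} {x} {s s′ : Fin k → Bool} → s ≗ s′ → x ∷ᵛ s ≗ x ∷ᵛ s′
    ∷-cong eq zero    = refl
    ∷-cong eq (suc i) = eq i

    ∷-++ : ∀ {a b} (x : Bool) (s₁ : Fin a → Bool) (s₂ : Fin b → Bool) →
      x ∷ᵛ (s₁ ++ᵛ s₂) ≗ (x ∷ᵛ s₁) ++ᵛ s₂
    ∷-++ x s₁ s₂ zero    = refl
    ∷-++ {a} x s₁ s₂ (suc i) with splitAt a i
    ... | inj₁ _ = refl
    ... | inj₂ _ = refl

    ++-congʳ : ∀ {a b} {s₁ s₁′ : Fin a → Bool} (s₂ : Fin b → Bool) → s₁ ≗ s₁′ →
      s₁ ++ᵛ s₂ ≗ s₁′ ++ᵛ s₂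
    ++-congʳ {a} s₂ eq i with splitAt a i
    ... | inj₁ j = eq j
    ... | inj₂ _ = refl

  subsets-++ : ∀ a b {f : (Fin (a ℕ.+ b) → Bool) → Carrier} → Extensional f →
    sumL (subsets (a ℕ.+ b)) f ≈ sumL (subsets a) (λ s₁ → sumL (subsets b) (λ s₂ → f (s₁ ++ᵛ s₂)))
  subsets-++ zero    b ext = ≈-sym (+-identityʳ _)
  subsets-++ (suc a) b {f} ext = begin
    sumL (subsets (suc (a ℕ.+ b))) f
      ≈⟨ subsets-suc (a ℕ.+ b) ext ⟩
    sumL (subsets (a ℕ.+ b)) (λ s → f (false ∷ᵛ s) + f (true ∷ᵛ s))
      ≈⟨ subsets-++ a b (λ eq → +-cong (ext (∷-cong eq)) (ext (∷-cong eq))) ⟩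
    sumL (subsets a) (λ s₁ → sumL (subsets b) λ s₂ →
      f (false ∷ᵛ (s₁ ++ᵛ s₂)) + f (true ∷ᵛ (s₁ ++ᵛ s₂)))
      ≈⟨ sumL-cong (subsets a) (λ s₁ → ≈-trans (sumL-+ (subsets b) _ _)
           (+-cong (sumL-cong (subsets b) λ s₂ → ext (∷-++ false s₁ s₂))
                   (sumL-cong (subsets b) λ s₂ → ext (∷-++ true s₁ s₂)))) ⟩
    sumL (subsets a) (λ s₁ → sumL (subsets b) (λ s₂ → f ((false ∷ᵛ s₁) ++ᵛ s₂))
                           + sumL (subsets b) (λ s₂ → f ((true ∷ᵛ s₁) ++ᵛ s₂)))
      ≈⟨ subsets-suc a (λ eq → sumL-cong (subsets b) λ s₂ → ext (++-congʳ s₂ eq)) ⟨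
    sumL (subsets (suc a)) (λ s₁ → sumL (subsets b) (λ s₂ → f (s₁ ++ᵛ s₂))) ∎

  SubsetFamily : (m : ℕ) → (Fin m → ℕ) → Set
  SubsetFamily m q = (i : Fin m) → Fin (q i) → Bool

  consFamily : ∀ {m} {q : Fin (suc m) → ℕ} →
    (Fin (q zero) → Bool) → SubsetFamily m (q ∘ suc) → SubsetFamily (suc m) q
  consFamily t ts zero    = t
  consFamily t ts (suc i) = ts i

  consFamily-cong : ∀ {m} {q : Fin (suc m) → ℕ} (t : Fin (q zero) → Bool)
    {ts ts′ : SubsetFamily m (q ∘ suc)} →
    (∀ i → ts i ≗ ts′ i) → ∀ i → consFamily {q = q} t ts i ≗ consFamily {q = q} t ts′ i
  consFamily-cong t eq zero    j = refl
  consFamily-cong t eq (suc i) j = eq i j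

  sumFamilies : ∀ m q → (SubsetFamily m q → Carrier) → Carrier
  sumFamilies zero    q f = f (λ ())
  sumFamilies (suc m) q f = sumL (subsets (q zero)) λ t → sumFamilies m (q ∘ suc) (f ∘ consFamily t)

  FamilyExtensional : ∀ {m q} → (SubsetFamily m q → Carrier) → Set _
  FamilyExtensional f = ∀ {ts ts′} → (∀ i → ts i ≗ ts′ i) → f ts ≈ f ts′

  sumFamilies-cong : ∀ m q {f g : SubsetFamily m q → Carrier} → (∀ ts → f ts ≈ g ts) →
    sumFamilies m q f ≈ sumFamilies m q g
  sumFamilies-cong zero    q f≈g = f≈g _
  sumFamilies-cong (suc m) q f≈g =
    sumL-cong (subsets (q zero)) λ t → sumFamilies-cong m (q ∘ suc) (f≈g ∘ consFamily t)

  sumFamilies-*ˡ : ∀ m q k (f : SubsetFamily m q → Carrier) →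
    k * sumFamilies m q f ≈ sumFamilies m q (λ ts → k * f ts)
  sumFamilies-*ˡ zero    q k f = ≈-refl
  sumFamilies-*ˡ (suc m) q k f = ≈-trans (sumL-*ˡ (subsets (q zero)) k _)
    (sumL-cong (subsets (q zero)) λ t → sumFamilies-*ˡ m (q ∘ suc) k _)

  sumL-sumFamilies : ∀ {A : Set} (xs : List A) m q (f : A → SubsetFamily m q → Carrier) →
    sumL xs (λ x → sumFamilies m q (f x)) ≈ sumFamilies m q (λ ts → sumL xs (λ x → f x ts))
  sumL-sumFamilies xs zero    q f = ≈-refl
  sumL-sumFamilies xs (suc m) q f = ≈-trans (sumL-swap xs (subsets (q zero)) _)
    (sumL-cong (subsets (q zero)) λ t → sumL-sumFamilies xs m (q ∘ suc) (λ x → f x ∘ consFamily t))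

  prodFin-sumL : ∀ m q (g : (i : Fin m) → (Fin (q i) → Bool) → Carrier) →
    prodFin m (λ i → sumL (subsets (q i)) (g i)) ≈ sumFamilies m q (λ ts → prodFin m (λ i → g i (ts i)))
  prodFin-sumL zero    q g = ≈-refl
  prodFin-sumL (suc m) q g = ≈-trans (*-congˡ (prodFin-sumL m (q ∘ suc) (g ∘ suc)))
    (≈-trans (sumL-*ʳ (subsets (q zero)) _ _)
           (sumL-cong (subsets (q zero)) λ t → sumFamilies-*ˡ m (q ∘ suc) (g zero t) _))

  unflatten : ∀ m q → (Fin (sumFin m q) → Bool) → SubsetFamily m q
  unflatten m q x i = x ∘ injΣ m q i

  subsets-sumFin : ∀ m q {f : SubsetFamily m q → Carrier} → FamilyExtensional f →
    sumL (subsets (sumFin m q)) (f ∘ unflatten m q) ≈ sumFamilies m q f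
  subsets-sumFin zero    q ext = ≈-trans (+-identityʳ _) (ext λ ())
  subsets-sumFin (suc m) q {f} ext = begin
    sumL (subsets (q zero ℕ.+ rest)) (f ∘ unflatten (suc m) q)
      ≈⟨ subsets-++ (q zero) rest (λ eq → ext λ i j → eq _) ⟩
    sumL (subsets (q zero)) (λ t → sumL (subsets rest) (λ x → f (unflatten (suc m) q (t ++ᵛ x))))
      ≈⟨ sumL-cong (subsets (q zero)) (λ t → sumL-cong (subsets rest) λ x → ext (split t x)) ⟩
    sumL (subsets (q zero)) (λ t → sumL (subsets rest) (λ x → f (consFamily t (unflatten m (q ∘ suc) x))))
      ≈⟨ sumL-cong (subsets (q zero)) (λ t → subsets-sumFin m (q ∘ suc)
           λ eq → ext (consFamily-cong t eq)) ⟩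
    sumFamilies (suc m) q f ∎
    where
    rest : ℕ
    rest = sumFin m (q ∘ suc)
    split : ∀ t x i → unflatten (suc m) q (t ++ᵛ x) i ≗ consFamily {q = q} t (unflatten m (q ∘ suc) x) i
    split t x zero    j = cong [ t , x ]′ (splitAt-↑ˡ (q zero) j rest)
    split t x (suc i) j = cong [ t , x ]′ (splitAt-↑ʳ (q zero) rest (injΣ m (q ∘ suc) i j))

  private
    sum-Bool-single : ∀ (X : Bool → Carrier) b → X (not b) ≈ 0# → X false + X true ≈ X b
    sum-Bool-single X true  X₀≈0 = ≈-trans (+-congʳ X₀≈0) (+-identityˡ _)
    sum-Bool-single X false X₁≈0 = ≈-trans (+-congˡ X₁≈0) (+-identityʳ _)

  sumSubsets-concentrated : ∀ k {F : (Fin k → Bool) → Carrier} → Extensional F →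
    (g : Fin k → Bool → Carrier) (c : Fin k → Bool) → (∀ i → g i (not (c i)) ≈ 0#) →
    sumL (subsets k) (λ s → F s * prodFin k (λ i → g i (s i))) ≈ F c * prodFin k (λ i → g i (c i))
  sumSubsets-concentrated zero    ext g c vanish = ≈-trans (+-identityʳ _) (*-congʳ (ext λ ()))
  sumSubsets-concentrated (suc k) {F} ext g c vanish = begin
    sumL (subsets (suc k)) (λ s → F s * prodFin (suc k) (λ i → g i (s i)))
      ≈⟨ subsets-suc k (λ eq → *-cong (ext eq) (prodFin-cong (suc k) λ i → reflexive (cong (g i) (eq i)))) ⟩
    sumL (subsets k) (λ s → X s false + X s true)
      ≈⟨ sumL-cong (subsets k) (λ s → sum-Bool-single (X s) (c zero)
           (≈-trans (*-congˡ (≈-trans (*-congʳ (vanish zero)) (zeroˡ _))) (zeroʳ _))) ⟩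
    sumL (subsets k) (λ s → X s (c zero))
      ≈⟨ sumL-cong (subsets k) (λ s → ≈-sym (*-assoc _ _ _)) ⟩
    sumL (subsets k) (λ s → (F (c zero ∷ᵛ s) * g zero (c zero)) * Π s)
      ≈⟨ sumSubsets-concentrated k (λ eq → *-congʳ (ext (∷-cong eq))) (g ∘ suc) (c ∘ suc) (vanish ∘ suc) ⟩
    (F (c zero ∷ᵛ (c ∘ suc)) * g zero (c zero)) * Π (c ∘ suc)
      ≈⟨ *-assoc _ _ _ ⟩
    F (c zero ∷ᵛ (c ∘ suc)) * (g zero (c zero) * Π (c ∘ suc))
      ≈⟨ *-congʳ (ext λ { zero → refl ; (suc i) → refl }) ⟩
    F c * prodFin (suc k) (λ i → g i (c i)) ∎
    where
    Π : (Fin k → Bool) → Carrier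
    Π s = prodFin k (λ i → g (suc i) (s i))
    X : (Fin k → Bool) → Bool → Carrier
    X s b = F (b ∷ᵛ s) * (g zero b * Π s)

module Expansion {c ℓ : Level} (R : CommutativeSemiring c ℓ) (a b : CommutativeSemiring.Carrier R) where

  open CommutativeSemiring R hiding (zero; refl; sym; trans)
  open CommutativeSemiring R using () renaming (refl to ≈-refl; sym to ≈-sym; trans to ≈-trans)
  open Eval R
  open Sums R
  open import Relation.Binary.Reasoning.Setoid setoid

  private
    summand : Bool → (joined : Bool) → (components edges : ℕ) → Carrier
    summand true  joined k e = if joined then pow a (k ∸ 1) * pow b e else 0#
    summand false joined k e = if joined then 0# else pow a (k ∸ 2) * pow b e

  -- phiTerm true H and phiTerm false H are the summands of phi1 H a b and phi2 H a b.
  phiTerm : Bool → (H : TGraph) → State (toGraph H) → Carrier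
  phiTerm x H t = summand x (connected (toGraph H) t zero (suc zero))
    (numComponents (toGraph H) t) (numEdges (toGraph H) t)

  phiTerm-cong : ∀ x H {t t′} → t ≗ t′ → phiTerm x H t ≡ phiTerm x H t′
  phiTerm-cong x H t≗t′ =
    cong₂ (λ j (k , e) → summand x j k e) (connected-cong (toGraph H) t≗t′ zero (suc zero))
    (cong₂ _,_ (numComponents-cong (toGraph H) t≗t′) (numEdges-cong (toGraph H) t≗t′))

  private
    summand-vanishes : ∀ j k e → summand (not j) j k e ≈ 0#
    summand-vanishes true  k e = ≈-refl
    summand-vanishes false k e = ≈-refl

    summand-joined : ∀ j {k i} e → k ≡ (if j then 1 else 2) ℕ.+ i → summand j j k e ≈ pow a i * pow b e
    summand-joined true  e refl = ≈-refl
    summand-joined false e refl = ≈-refl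

  phiTerm-vanishes : ∀ H t → phiTerm (not (connected (toGraph H) t zero (suc zero))) H t ≈ 0#
  phiTerm-vanishes H t = summand-vanishes (connected (toGraph H) t zero (suc zero)) _ _

  phiTerm-value : ∀ H t → phiTerm (connected (toGraph H) t zero (suc zero)) H t ≈
    pow a (numInnerComponents H t) * pow b (numEdges (toGraph H) t)
  phiTerm-value H t = summand-joined (connected (toGraph H) t zero (suc zero)) _ (numComponents-terminals H t)

  phi-factors : ∀ x H → (if x then phi1 H a b else 1#) * (if x then 1# else phi2 H a b) ≈
    sumL (states (toGraph H)) (phiTerm x H)
  phi-factors true  H = *-identityʳ _
  phi-factors false H = *-identityˡ _

  module _ (G : Graph) (H : Fin (nE G) → TGraph) where

    private
      m : ℕ
      m = nE G
      q : Fin m → ℕ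
      q = tE ∘ H
      Ĝ : Graph
      Ĝ = twoSumAll G H
      open TwoSum G H

    -- The common value of both sides, as a sum over families of states of the H e.
    Φ : SubsetFamily m q → Carrier
    Φ ts = pow a (numComponents G (terminalsJoined G H ts))
         * prodFin m (λ e → phiTerm (terminalsJoined G H ts e) (H e) (ts e))

    Φ-ext : FamilyExtensional Φ
    Φ-ext {ts} {ts′} ts≗ts′ = *-cong (reflexive (cong (pow a) (numComponents-cong G joined≗)))
      (prodFin-cong m λ e → reflexive (trans (cong (λ j → phiTerm j (H e) (ts e)) (joined≗ e))
                                          (phiTerm-cong (terminalsJoined G H ts′ e) (H e) (ts≗ts′ e))))
      where
      joined≗ : terminalsJoined G H ts ≗ terminalsJoined G H ts′
      joined≗ = λ e → connected-cong (toGraph (H e)) (ts≗ts′ e) zero (suc zero)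

    Z-twoSumAll : Z Ĝ a b ≈ sumFamilies m q Φ
    Z-twoSumAll = ≈-trans (sumL-cong (states Ĝ) state-weight) (subsets-sumFin m q Φ-ext)
      where
      state-weight : ∀ x → pow a (numComponents Ĝ x) * pow b (numEdges Ĝ x) ≈ Φ (restrict x)
      state-weight x = begin
        pow a (numComponents Ĝ x) * pow b (numEdges Ĝ x)
          ≈⟨ reflexive (cong₂ (λ k e → pow a k * pow b e) (numComponents-twoSum x) (numEdges-twoSum x)) ⟩
        pow a (kᴳ ℕ.+ sumFin m I) * pow b (sumFin m E)
          ≈⟨ *-cong (pow-+ a kᴳ _) (pow-sumFin b m E) ⟩
        (pow a kᴳ * pow a (sumFin m I)) * prodFin m (pow b ∘ E)
          ≈⟨ *-assoc _ _ _ ⟩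
        pow a kᴳ * (pow a (sumFin m I) * prodFin m (pow b ∘ E))
          ≈⟨ *-congˡ (*-congʳ (pow-sumFin a m I)) ⟩
        pow a kᴳ * (prodFin m (pow a ∘ I) * prodFin m (pow b ∘ E))
          ≈⟨ *-congˡ (prodFin-* m _ _) ⟨
        pow a kᴳ * prodFin m (λ e → pow a (I e) * pow b (E e))
          ≈⟨ *-congˡ (prodFin-cong m λ e → phiTerm-value (H e) (restrict x e)) ⟨
        Φ (restrict x) ∎
        where
        kᴳ : ℕ
        kᴳ = numComponents G (terminalsJoined G H (restrict x))
        I : Fin m → ℕ
        I e = numInnerComponents (H e) (restrict x e)
        E : Fin m → ℕ
        E e = numEdges (toGraph (H e)) (restrict x e)

    rhs≈sumFamilies : rhs G H a b ≈ sumFamilies m q Φ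
    rhs≈sumFamilies = begin
      rhs G H a b
        ≈⟨ sumL-cong (states G) (λ s → *-congˡ (≈-trans (≈-sym (prodFin-* m _ _))
             (prodFin-cong m λ e → phi-factors (s e) (H e)))) ⟩
      sumL (states G) (λ s → pow a (numComponents G s) * prodFin m (λ e → φ (s e) e))
        ≈⟨ sumL-cong (states G) (λ s → ≈-trans (*-congˡ (prodFin-sumL m q _)) (sumFamilies-*ˡ m q _ _)) ⟩
      sumL (states G) (λ s → sumFamilies m q (term s))
        ≈⟨ sumL-sumFamilies (states G) m q term ⟩
      sumFamilies m q (λ ts → sumL (states G) λ s → term s ts)
        ≈⟨ sumFamilies-cong m q (λ ts →
             sumSubsets-concentrated m (reflexive ∘ cong (pow a) ∘ numComponents-cong G)
               (λ e j → phiTerm j (H e) (ts e)) (terminalsJoined G H ts) (λ e → phiTerm-vanishes (H e) (ts e))) ⟩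
      sumFamilies m q Φ ∎
      where
      φ : Bool → Fin m → Carrier
      φ j e = sumL (states (toGraph (H e))) (phiTerm j (H e))

      term : State G → SubsetFamily m q → Carrier
      term s ts = pow a (numComponents G s) * prodFin m (λ e → phiTerm (s e) (H e) (ts e))

lemma3p2 : {c ℓ : Level} (R : CommutativeSemiring c ℓ) →
    (G : Graph) (H : Fin (nE G) → TGraph) →
    (a b : CommutativeSemiring.Carrier R) →
    CommutativeSemiring._≈_ R (Eval.Z R (twoSumAll G H) a b) (Eval.rhs R G H a b)
lemma3p2 R G H a b = begin
  Z (twoSumAll G H) a b                ≈⟨ Z-twoSumAll G H ⟩
  sumFamilies (nE G) (tE ∘ H) (Φ G H)  ≈⟨ rhs≈sumFamilies G H ⟨
  rhs G H a b                          ∎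
  where
  open CommutativeSemiring R using (setoid)
  open Eval R using (Z; rhs)
  open Sums R using (sumFamilies)
  open Expansion R a b
  open import Relation.Binary.Reasoning.Setoid setoid
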